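{- (1) If $\Gamma\vdash M[N/x]:\delta\mid\Delta$ and $\Gamma\vdash N:\delta'\mid\Delta$, then $\Gamma\vdash(\lambda x.M)N:\delta\mid\Delta$. (2) If $\Gamma\vdash\mu\alpha.(([\beta]M)[\alpha\Leftarrow N]):\delta\mid\Delta$ and $\Gamma\vdash N:\delta'\mid\Delta$, then $\Gamma\vdash(\mu\alpha.[\beta]M)N:\delta\mid\Delta$.
   Context: Pure $\lambda\mu$-calculus: terms $M,N ::= x \mid \lambda x.M \mid MN \mid \mu\alpha.C$, commands $C ::= [\alpha]M$, over disjoint denumerable sets of term variables and names; $\lambda$ binds $x$, $\mu$ binds $\alpha$; bound and free variables/names kept distinct. $M[N/x]$ is capture-avoiding substitution; structural substitution $T[\alpha\Leftarrow L]$ replaces every subcommand $[\alpha]P$ of $T$ by $[\alpha](P[\alpha\Leftarrow L])L$ and commutes with other constructs. Types: with a single constant $\nu$ and a symbol $\omega$ (not itself a type), term types $\delta ::= \nu \mid \omega\to\nu \mid \kappa\to\nu \mid \delta\wedge\delta$ and stack types $\kappa ::= \delta\times\omega \mid \delta\times\kappa \mid \kappa\wedge\kappa$. The preorder $\le$ is the least preorder with: $\sigma\wedge\tau\le\sigma$; $\sigma\wedge\tau\le\tau$; $\nu\le\omega\to\nu$; $\omega\to\nu\le\nu$; $\delta_1\times\delta_2\times\omega\le\delta_1\times\omega$; $(\delta_1\times\omega)\wedge(\delta_2\times\kappa)\le(\delta_1\wedge\delta_2)\times\kappa$; $(\delta_1\times\kappa_1)\wedge(\delta_2\times\kappa_2)\le(\delta_1\wedge\delta_2)\times(\kappa_1\wedge\kappa_2)$;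 $\delta_1\le\delta_2\Rightarrow\delta_1\times\omega\le\delta_2\times\omega$; $\delta_1\le\delta_2,\kappa_1\le\kappa_2\Rightarrow\delta_1\times\kappa_1\le\delta_2\times\kappa_2$; $\sigma\le\tau_1,\sigma\le\tau_2\Rightarrow\sigma\le\tau_1\wedge\tau_2$; $\kappa_2\le\kappa_1\Rightarrow\kappa_1\to\nu\le\kappa_2\to\nu$. Bases $\Gamma$ map finitely many term variables to term types; name contexts $\Delta$ map finitely many names to stack types; comma = disjoint extension. Typing rules: (ax) $\Gamma,x{:}\delta\vdash x:\delta\mid\Delta$; (abs) from $\Gamma,x{:}\delta\vdash M:\kappa\to\nu\mid\Delta$ infer $\Gamma\vdash\lambda x.M:\delta\times\kappa\to\nu\mid\Delta$; (app) from $\Gamma\vdash M:\delta\times\kappa\to\nu\mid\Delta$ and $\Gamma\vdash N:\delta\mid\Delta$ infer $\Gamma\vdash MN:\kappa\to\nu\mid\Delta$ ($\kappa$ a stack type or $\omega$ in (abs), (app)); ($\mu$) from $\Gamma\vdash M:\kappa\to\nu\mid\alpha{:}\kappa,\Delta$ infer $\Gamma\vdash\mu\alpha.[\alpha]M:\kappa\to\nu\mid\Delta$, and for $\alpha\ne\beta$ from $\Gamma\vdash M:\kappa'\to\nu\mid\alpha{:}\kappa,\beta{:}\kappa',\Delta$ infer $\Gamma\vdash\mu\alpha.[\beta]M:\kappa\to\nu\mid\beta{:}\kappa',\Delta$; ($\le$) from $\Gamma\vdash M:\delta\mid\Delta$ and $\delta\le\delta'$ infer $\Gamma\vdash M:\delta'\mid\Delta$;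 ($\wedge$) from $\Gamma\vdash M:\delta\mid\Delta$ and $\Gamma\vdash M:\delta'\mid\Delta$ infer $\Gamma\vdash M:\delta\wedge\delta'\mid\Delta$. Variables in $\Gamma$ and names in $\Delta$ are not bound in the typed term. -}

module Defs where

open import Data.Nat using (ℕ; zero; suc)
open import Data.Fin using (Fin; zero; suc; _≟_)
open import Data.Vec using (Vec; []; _∷_; lookup)
open import Relation.Nullary using (yes; no)

-- Syntax of the pure λμ-calculus, well-scoped de Bruijn representation.
-- Term n m : terms whose free term variables are among n and whose free
-- names are among m (index 0 = most recently bound).

mutual
  data Term (n m : ℕ) : Set where
    var : Fin n → Term n m
    lam : Term (suc n) m → Term n m
    app : Term n m → Term n m → Term n m
    mu  : Cmd n (suc m) → Term n m

  data Cmd (n m : ℕ) : Set where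
    [_]_ : Fin m → Term n m → Cmd n m

ext : ∀ {n n'} → (Fin n → Fin n') → Fin (suc n) → Fin (suc n')
ext ρ zero    = zero
ext ρ (suc i) = suc (ρ i)

mutual
  renV : ∀ {n n' m} → (Fin n → Fin n') → Term n m → Term n' m
  renV ρ (var x)   = var (ρ x)
  renV ρ (lam M)   = lam (renV (ext ρ) M)
  renV ρ (app M N) = app (renV ρ M) (renV ρ N)
  renV ρ (mu C)    = mu (renVC ρ C)

  renVC : ∀ {n n' m} → (Fin n → Fin n') → Cmd n m → Cmd n' m
  renVC ρ ([ a ] M) = [ a ] renV ρ M

mutual
  renN : ∀ {n m m'} → (Fin m → Fin m') → Term n m → Term n m'
  renN ρ (var x)   = var x
  renN ρ (lam M)   = lam (renN ρ M)
  renN ρ (app M N) = app (renN ρ M) (renN ρ N)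
  renN ρ (mu C)    = mu (renNC (ext ρ) C)

  renNC : ∀ {n m m'} → (Fin m → Fin m') → Cmd n m → Cmd n m'
  renNC ρ ([ a ] M) = [ ρ a ] renN ρ M

exts : ∀ {n n' m} → (Fin n → Term n' m) → Fin (suc n) → Term (suc n') m
exts σ zero    = var zero
exts σ (suc i) = renV suc (σ i)

mutual
  substV : ∀ {n n' m} → (Fin n → Term n' m) → Term n m → Term n' m
  substV σ (var x)   = σ x
  substV σ (lam M)   = lam (substV (exts σ) M)
  substV σ (app M N) = app (substV σ M) (substV σ N)
  substV σ (mu C)    = mu (substVC (λ i → renN suc (σ i)) C)

  substVC : ∀ {n n' m} → (Fin n → Term n' m) → Cmd n m → Cmd n' m
  substVC σ ([ a ] M) = [ a ] substV σ M

single : ∀ {n m} → Term n m → Fin (suc n) → Term n m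
single N zero    = N
single N (suc i) = var i

_[_/0] : ∀ {n m} → Term (suc n) m → Term n m → Term n m
M [ N /0] = substV (single N) M

-- structural substitution T[α ⇐ L]: every subcommand [α]P becomes
-- [α]((P[α ⇐ L]) L); commutes with all other constructs
-- (L is weakened when going under binders, so no capture occurs).
mutual
  strSub : ∀ {n m} → Term n m → Fin m → Term n m → Term n m
  strSub (var x)   α L = var x
  strSub (lam M)   α L = lam (strSub M α (renV suc L))
  strSub (app M N) α L = app (strSub M α L) (strSub N α L)
  strSub (mu C)    α L = mu (strSubC C (suc α) (renN suc L))

  strSubC : ∀ {n m} → Cmd n m → Fin m → Term n m → Cmd n m
  strSubC ([ β ] P) α L with β ≟ α
  ... | yes _ = [ β ] app (strSub P α L) L
  ... | no  _ = [ β ] strSub P α L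

infixr 7 _×ₛ_ _×ω
infixl 6 _∧_ _∧ₛ_

mutual
  data TType : Set where
    ν    : TType
    ω⇒ν  : TType
    _⇒ν  : SType → TType
    _∧_  : TType → TType → TType

  data SType : Set where
    _×ω  : TType → SType
    _×ₛ_ : TType → SType → SType
    _∧ₛ_ : SType → SType → SType

-- "κ a stack type or ω" in rules (abs), (app)
data Tail : Set where
  ω   : Tail
  stk : SType → Tail

arr : Tail → TType
arr ω       = ω⇒ν
arr (stk κ) = κ ⇒ν

cons : TType → Tail → SType
cons δ ω       = δ ×ω
cons δ (stk κ) = δ ×ₛ κ

infix 4 _≤ₜ_ _≤ₛ_
mutual
  data _≤ₜ_ : TType → TType → Set where
    reflₜ   : ∀ {σ} → σ ≤ₜ σ
    transₜ  : ∀ {σ τ ρ} → σ ≤ₜ τ → τ ≤ₜ ρ → σ ≤ₜ ρ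
    ∧-lbₜ   : ∀ {σ τ} → σ ∧ τ ≤ₜ σ
    ∧-rbₜ   : ∀ {σ τ} → σ ∧ τ ≤ₜ τ
    ν≤ων    : ν ≤ₜ ω⇒ν
    ων≤ν    : ω⇒ν ≤ₜ ν
    ∧-glbₜ  : ∀ {σ τ₁ τ₂} → σ ≤ₜ τ₁ → σ ≤ₜ τ₂ → σ ≤ₜ τ₁ ∧ τ₂
    ⇒-contra : ∀ {κ₁ κ₂} → κ₂ ≤ₛ κ₁ → κ₁ ⇒ν ≤ₜ κ₂ ⇒ν

  data _≤ₛ_ : SType → SType → Set where
    reflₛ   : ∀ {σ} → σ ≤ₛ σ
    transₛ  : ∀ {σ τ ρ} → σ ≤ₛ τ → τ ≤ₛ ρ → σ ≤ₛ ρ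
    ∧-lbₛ   : ∀ {σ τ} → σ ∧ₛ τ ≤ₛ σ
    ∧-rbₛ   : ∀ {σ τ} → σ ∧ₛ τ ≤ₛ τ
    drop    : ∀ {δ₁ δ₂} → δ₁ ×ₛ (δ₂ ×ω) ≤ₛ δ₁ ×ω
    ∧-×ω    : ∀ {δ₁ δ₂ κ} → (δ₁ ×ω) ∧ₛ (δ₂ ×ₛ κ) ≤ₛ (δ₁ ∧ δ₂) ×ₛ κ
    ∧-×     : ∀ {δ₁ δ₂ κ₁ κ₂} →
              (δ₁ ×ₛ κ₁) ∧ₛ (δ₂ ×ₛ κ₂) ≤ₛ (δ₁ ∧ δ₂) ×ₛ (κ₁ ∧ₛ κ₂)
    mono-×ω : ∀ {δ₁ δ₂} → δ₁ ≤ₜ δ₂ → δ₁ ×ω ≤ₛ δ₂ ×ω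
    mono-×  : ∀ {δ₁ δ₂ κ₁ κ₂} → δ₁ ≤ₜ δ₂ → κ₁ ≤ₛ κ₂ → δ₁ ×ₛ κ₁ ≤ₛ δ₂ ×ₛ κ₂
    ∧-glbₛ  : ∀ {σ τ₁ τ₂} → σ ≤ₛ τ₁ → σ ≤ₛ τ₂ → σ ≤ₛ τ₁ ∧ₛ τ₂

infix 3 _⊢_∶_∣_
data _⊢_∶_∣_ {n m : ℕ} (Γ : Vec TType n) : Term n m → TType → Vec SType m → Set where
  ax   : ∀ {x Δ} → Γ ⊢ var x ∶ lookup Γ x ∣ Δ
  abs  : ∀ {M δ κ Δ} → (δ ∷ Γ) ⊢ M ∶ arr κ ∣ Δ → Γ ⊢ lam M ∶ cons δ κ ⇒ν ∣ Δ
  appT : ∀ {M N δ κ Δ} → Γ ⊢ M ∶ cons δ κ ⇒ν ∣ Δ → Γ ⊢ N ∶ δ ∣ Δ →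
         Γ ⊢ app M N ∶ arr κ ∣ Δ
  mu₁  : ∀ {M κ Δ} → Γ ⊢ M ∶ κ ⇒ν ∣ (κ ∷ Δ) → Γ ⊢ mu ([ zero ] M) ∶ κ ⇒ν ∣ Δ
  mu₂  : ∀ {M κ β Δ} → Γ ⊢ M ∶ lookup Δ β ⇒ν ∣ (κ ∷ Δ) →
         Γ ⊢ mu ([ suc β ] M) ∶ κ ⇒ν ∣ Δ
  sub  : ∀ {M δ δ' Δ} → Γ ⊢ M ∶ δ ∣ Δ → δ ≤ₜ δ' → Γ ⊢ M ∶ δ' ∣ Δ
  meet : ∀ {M δ δ' Δ} → Γ ⊢ M ∶ δ ∣ Δ → Γ ⊢ M ∶ δ' ∣ Δ → Γ ⊢ M ∶ δ ∧ δ' ∣ Δ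

-- Subject expansion by inverting the substitution. In a typing of M[N/x] each
-- occurrence of N is typed on its own; the intersection δ of those types can be
-- given to x, and N gets δ by (∧). Likewise the copies of N that [α ⇐ N]
-- appends to the commands named α are typed at types whose intersection δ turns
-- α : κ into α : δ × κ. When x (resp. α) does not occur, the assumed typing of N
-- fills in. Each inversion invariant is a filter of types, which absorbs (≤)
-- and (∧).

module Submission where

open import Defs
open import Data.Nat using (ℕ; suc)
open import Data.Fin using (Fin; zero; suc; _≟_)
open import Data.Vec using (Vec; []; _∷_; lookup; zipWith; _[_]≔_)
open import Data.Vec.Properties using (lookup∘update; lookup∘update′; lookup-zipWith)
open import Data.Vec.Relation.Binary.Pointwise.Inductive as Pointwise using (Pointwise; []; _∷_)
open import Data.Vec.Relation.Binary.Pointwise.Extensional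
  using (extensional⇒inductive) renaming (ext to pointwise)
open import Data.Product using (_×_; Σ-syntax; _,_)
open import Function using (_∘_)
open import Relation.Binary.PropositionalEquality using (refl; sym; subst; _≗_)
open import Relation.Nullary using (yes; no)

private
  variable
    n n' m m' k : ℕ
    Γ Γ₁ Γ₂ : Vec TType n
    Γ' : Vec TType n'
    Θ₀ : Vec TType k
    Δ Δ₁ Δ₂ : Vec SType m
    Δ' : Vec SType m'
    t L : Term n m
    δ τ : TType
    κ : SType
    α : Fin m

_≤Γ_ : Vec TType n → Vec TType n → Set
_≤Γ_ = Pointwise _≤ₜ_

_≤Δ_ : Vec SType m → Vec SType m → Set
_≤Δ_ = Pointwise _≤ₛ_

_⊓_ : Vec TType n → Vec TType n → Vec TType n
_⊓_ = zipWith _∧_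

⊓-≤ˡ : (Γ₁ Γ₂ : Vec TType n) → (Γ₁ ⊓ Γ₂) ≤Γ Γ₁
⊓-≤ˡ []       []       = []
⊓-≤ˡ (_ ∷ Γ₁) (_ ∷ Γ₂) = ∧-lbₜ ∷ ⊓-≤ˡ Γ₁ Γ₂

⊓-≤ʳ : (Γ₁ Γ₂ : Vec TType n) → (Γ₁ ⊓ Γ₂) ≤Γ Γ₂
⊓-≤ʳ []       []       = []
⊓-≤ʳ (_ ∷ Γ₁) (_ ∷ Γ₂) = ∧-rbₜ ∷ ⊓-≤ʳ Γ₁ Γ₂

≔-mono : ∀ {κ₁ κ₂} (Δ : Vec SType m) α → κ₁ ≤ₛ κ₂ → (Δ [ α ]≔ κ₁) ≤Δ (Δ [ α ]≔ κ₂)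
≔-mono (_ ∷ Δ) zero    p = p ∷ Pointwise.refl reflₛ
≔-mono (_ ∷ Δ) (suc α) p = reflₛ ∷ ≔-mono Δ α p

narrowΓ : Γ₁ ≤Γ Γ₂ → Γ₂ ⊢ t ∶ τ ∣ Δ → Γ₁ ⊢ t ∶ τ ∣ Δ
narrowΓ h (ax {x})   = sub ax (Pointwise.lookup h x)
narrowΓ h (abs D)    = abs (narrowΓ (reflₜ ∷ h) D)
narrowΓ h (appT D E) = appT (narrowΓ h D) (narrowΓ h E)
narrowΓ h (mu₁ D)    = mu₁ (narrowΓ h D)
narrowΓ h (mu₂ D)    = mu₂ (narrowΓ h D)
narrowΓ h (sub D p)  = sub (narrowΓ h D) p
narrowΓ h (meet D E) = meet (narrowΓ h D) (narrowΓ h E)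

narrowΔ : Δ₁ ≤Δ Δ₂ → Γ ⊢ t ∶ τ ∣ Δ₂ → Γ ⊢ t ∶ τ ∣ Δ₁
narrowΔ h ax         = ax
narrowΔ h (abs D)    = abs (narrowΔ h D)
narrowΔ h (appT D E) = appT (narrowΔ h D) (narrowΔ h E)
narrowΔ h (mu₁ D)    = mu₁ (narrowΔ (reflₛ ∷ h) D)
narrowΔ h (mu₂ {β = β} D) = mu₂ (sub (narrowΔ (reflₛ ∷ h) D) (⇒-contra (Pointwise.lookup h β)))
narrowΔ h (sub D p)  = sub (narrowΔ h D) p
narrowΔ h (meet D E) = meet (narrowΔ h D) (narrowΔ h E)

infix 3 _⊢ᶜ_∣_
_⊢ᶜ_∣_ : Vec TType n → Cmd n m → Vec SType m → Set
Γ ⊢ᶜ [ a ] M ∣ Δ = Γ ⊢ M ∶ lookup Δ a ⇒ν ∣ Δ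

mu-intro : ∀ {C} → Γ ⊢ᶜ C ∣ κ ∷ Δ → Γ ⊢ mu C ∶ κ ⇒ν ∣ Δ
mu-intro {C = [ zero ] M}  D = mu₁ D
mu-intro {C = [ suc b ] M} D = mu₂ D

record Filter (Q : TType → Set) : Set where
  field
    upward   : Q τ → τ ≤ₜ δ → Q δ
    ∧-closed : Q τ → Q δ → Q (τ ∧ δ)
open Filter

typing-filter : Filter (λ τ → Γ ⊢ t ∶ τ ∣ Δ)
typing-filter = record { upward = sub ; ∧-closed = meet }

mu-elim : ∀ {Q C} → Filter Q → (∀ {κ} → Γ ⊢ᶜ C ∣ κ ∷ Δ → Q (κ ⇒ν)) →
          Γ ⊢ mu C ∶ τ ∣ Δ → Q τ
mu-elim F base (mu₁ D)    = base D
mu-elim F base (mu₂ D)    = base D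
mu-elim F base (sub D p)  = upward F (mu-elim F base D) p
mu-elim F base (meet D E) = ∧-closed F (mu-elim F base D) (mu-elim F base E)

var-gen : ∀ {x} → Γ ⊢ var x ∶ τ ∣ Δ → lookup Γ x ≤ₜ τ
var-gen ax         = reflₜ
var-gen (sub D p)  = transₜ (var-gen D) p
var-gen (meet D E) = ∧-glbₜ (var-gen D) (var-gen E)

infix 4 _⇒ν∈_
data _⇒ν∈_ (κ : SType) : TType → Set where
  here  : κ ⇒ν∈ κ ⇒ν
  left  : ∀ {σ τ} → κ ⇒ν∈ σ → κ ⇒ν∈ σ ∧ τ
  right : ∀ {σ τ} → κ ⇒ν∈ τ → κ ⇒ν∈ σ ∧ τ

⇒ν∈-≤ : ∀ {σ} → σ ≤ₜ τ → κ ⇒ν∈ τ → Σ[ κ' ∈ SType ] κ ≤ₛ κ' × κ' ⇒ν∈ σ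
⇒ν∈-≤ reflₜ a = _ , reflₛ , a
⇒ν∈-≤ (transₜ p q) a with ⇒ν∈-≤ q a
... | _ , l₁ , a₁ with ⇒ν∈-≤ p a₁
...   | κ₂ , l₂ , a₂ = κ₂ , transₛ l₁ l₂ , a₂
⇒ν∈-≤ ∧-lbₜ        a         = _ , reflₛ , left a
⇒ν∈-≤ ∧-rbₜ        a         = _ , reflₛ , right a
⇒ν∈-≤ (∧-glbₜ p q) (left a)  = ⇒ν∈-≤ p a
⇒ν∈-≤ (∧-glbₜ p q) (right a) = ⇒ν∈-≤ q a
⇒ν∈-≤ (⇒-contra l) here      = _ , l , here

app-gen : ∀ {M N} → Γ ⊢ app M N ∶ τ ∣ Δ → κ ⇒ν∈ τ →
          Σ[ δ ∈ TType ] Γ ⊢ M ∶ (δ ×ₛ κ) ⇒ν ∣ Δ × Γ ⊢ N ∶ δ ∣ Δ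
app-gen (appT {κ = stk _} D E) here = _ , D , E
app-gen (sub D p) a with ⇒ν∈-≤ p a
... | _ , l , a' with app-gen D a'
...   | δ , DM , DN = δ , sub DM (⇒-contra (mono-× reflₜ l)) , DN
app-gen (meet D E) (left a)  = app-gen D a
app-gen (meet D E) (right a) = app-gen E a

ext-≗ : ∀ {A : Set} {xs : Vec A n} {ys : Vec A n'} {ρ : Fin n → Fin n'} {a : A} →
        lookup ys ∘ ρ ≗ lookup xs → lookup (a ∷ ys) ∘ ext ρ ≗ lookup (a ∷ xs)
ext-≗ h zero    = refl
ext-≗ h (suc x) = h x

renV⁺ : (ρ : Fin n → Fin n') → lookup Γ' ∘ ρ ≗ lookup Γ →
        Γ ⊢ t ∶ τ ∣ Δ → Γ' ⊢ renV ρ t ∶ τ ∣ Δ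
renV⁺ ρ h (ax {x})   = subst (λ T → _ ⊢ var (ρ x) ∶ T ∣ _) (h x) ax
renV⁺ ρ h (abs D)    = abs (renV⁺ (ext ρ) (ext-≗ h) D)
renV⁺ ρ h (appT D E) = appT (renV⁺ ρ h D) (renV⁺ ρ h E)
renV⁺ ρ h (mu₁ D)    = mu₁ (renV⁺ ρ h D)
renV⁺ ρ h (mu₂ D)    = mu₂ (renV⁺ ρ h D)
renV⁺ ρ h (sub D p)  = sub (renV⁺ ρ h D) p
renV⁺ ρ h (meet D E) = meet (renV⁺ ρ h D) (renV⁺ ρ h E)

renV⁻ : (t : Term n m) (ρ : Fin n → Fin n') → lookup Γ' ∘ ρ ≗ lookup Γ →
        Γ' ⊢ renV ρ t ∶ τ ∣ Δ → Γ ⊢ t ∶ τ ∣ Δ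
renV⁻ {τ = τ} (var x) ρ h D = sub ax (subst (_≤ₜ τ) (h x) (var-gen D))
renV⁻ (mu ([ a ] M)) ρ h D  = mu-elim typing-filter (mu-intro ∘ renV⁻ M ρ h) D
renV⁻ t ρ h (sub D p)       = sub (renV⁻ t ρ h D) p
renV⁻ t ρ h (meet D E)      = meet (renV⁻ t ρ h D) (renV⁻ t ρ h E)
renV⁻ (lam M) ρ h (abs D)   = abs (renV⁻ M (ext ρ) (ext-≗ h) D)
renV⁻ (app M N) ρ h (appT D E) = appT (renV⁻ M ρ h D) (renV⁻ N ρ h E)

mutual
  renN⁺ : (ρ : Fin m → Fin m') → lookup Δ' ∘ ρ ≗ lookup Δ →
          Γ ⊢ t ∶ τ ∣ Δ → Γ ⊢ renN ρ t ∶ τ ∣ Δ'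
  renN⁺ ρ h ax         = ax
  renN⁺ ρ h (abs D)    = abs (renN⁺ ρ h D)
  renN⁺ ρ h (appT D E) = appT (renN⁺ ρ h D) (renN⁺ ρ h E)
  renN⁺ ρ h (mu₁ {M = M} D) = mu-intro (renNC⁺ ([ zero ] M) (ext ρ) (ext-≗ h) D)
  renN⁺ ρ h (mu₂ {M = M} {β = β} D) =
    mu-intro (renNC⁺ ([ suc β ] M) (ext ρ) (ext-≗ h) D)
  renN⁺ ρ h (sub D p)  = sub (renN⁺ ρ h D) p
  renN⁺ ρ h (meet D E) = meet (renN⁺ ρ h D) (renN⁺ ρ h E)

  renNC⁺ : (C : Cmd n m) (ρ : Fin m → Fin m') → lookup Δ' ∘ ρ ≗ lookup Δ →
           Γ ⊢ᶜ C ∣ Δ → Γ ⊢ᶜ renNC ρ C ∣ Δ'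
  renNC⁺ ([ a ] M) ρ h D = subst (λ κ → _ ⊢ renN ρ M ∶ κ ⇒ν ∣ _) (sym (h a)) (renN⁺ ρ h D)

mutual
  renN⁻ : (t : Term n m) (ρ : Fin m → Fin m') → lookup Δ' ∘ ρ ≗ lookup Δ →
          Γ ⊢ renN ρ t ∶ τ ∣ Δ' → Γ ⊢ t ∶ τ ∣ Δ
  renN⁻ (var x) ρ h D = sub ax (var-gen D)
  renN⁻ (mu C) ρ h D  = mu-elim typing-filter (mu-intro ∘ renNC⁻ C (ext ρ) (ext-≗ h)) D
  renN⁻ t ρ h (sub D p)  = sub (renN⁻ t ρ h D) p
  renN⁻ t ρ h (meet D E) = meet (renN⁻ t ρ h D) (renN⁻ t ρ h E)
  renN⁻ (lam M) ρ h (abs D) = abs (renN⁻ M ρ h D)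
  renN⁻ (app M N) ρ h (appT D E) = appT (renN⁻ M ρ h D) (renN⁻ N ρ h E)

  renNC⁻ : (C : Cmd n m) (ρ : Fin m → Fin m') → lookup Δ' ∘ ρ ≗ lookup Δ →
           Γ ⊢ᶜ renNC ρ C ∣ Δ' → Γ ⊢ᶜ C ∣ Δ
  renNC⁻ ([ a ] M) ρ h D = subst (λ κ → _ ⊢ M ∶ κ ⇒ν ∣ _) (h a) (renN⁻ M ρ h D)

renV-suc⁺ : Γ ⊢ t ∶ τ ∣ Δ → (δ ∷ Γ) ⊢ renV suc t ∶ τ ∣ Δ
renV-suc⁺ = renV⁺ suc (λ _ → refl)

renV-suc⁻ : (t : Term n m) → (δ ∷ Γ) ⊢ renV suc t ∶ τ ∣ Δ → Γ ⊢ t ∶ τ ∣ Δ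
renV-suc⁻ t = renV⁻ t suc (λ _ → refl)

renN-suc⁺ : Γ ⊢ t ∶ τ ∣ Δ → Γ ⊢ renN suc t ∶ τ ∣ κ ∷ Δ
renN-suc⁺ = renN⁺ suc (λ _ → refl)

renN-suc⁻ : (t : Term n m) → Γ ⊢ renN suc t ∶ τ ∣ κ ∷ Δ → Γ ⊢ t ∶ τ ∣ Δ
renN-suc⁻ t = renN⁻ t suc (λ _ → refl)

infix 3 _⊢ˢ_∶_∣_
record _⊢ˢ_∶_∣_ (Γ : Vec TType n) (σ : Fin k → Term n m) (Θ : Vec TType k)
                (Δ : Vec SType m) : Set where
  field at : ∀ i → Γ ⊢ σ i ∶ lookup Θ i ∣ Δ
open _⊢ˢ_∶_∣_

single-⊢ˢ : Γ ⊢ L ∶ δ ∣ Δ → Γ ⊢ˢ single L ∶ δ ∷ Γ ∣ Δ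
at (single-⊢ˢ DL) zero    = DL
at (single-⊢ˢ DL) (suc x) = ax

exts-⊢ˢ : ∀ {σ : Fin k → Term n m} → Γ ⊢ˢ σ ∶ Θ₀ ∣ Δ → (δ ∷ Γ) ⊢ˢ exts σ ∶ δ ∷ Θ₀ ∣ Δ
at (exts-⊢ˢ Dσ) zero    = ax
at (exts-⊢ˢ Dσ) (suc i) = renV-suc⁺ (at Dσ i)

renN-suc-⊢ˢ : ∀ {σ : Fin k → Term n m} → Γ ⊢ˢ σ ∶ Θ₀ ∣ Δ → Γ ⊢ˢ renN suc ∘ σ ∶ Θ₀ ∣ κ ∷ Δ
at (renN-suc-⊢ˢ Dσ) i = renN-suc⁺ (at Dσ i)

⊢ˢ-⊓ : ∀ {σ : Fin k → Term n m} {Θ₁ Θ₂} →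
       Γ ⊢ˢ σ ∶ Θ₁ ∣ Δ → Γ ⊢ˢ σ ∶ Θ₂ ∣ Δ → Γ ⊢ˢ σ ∶ Θ₁ ⊓ Θ₂ ∣ Δ
at (⊢ˢ-⊓ {Θ₁ = Θ₁} {Θ₂} D₁ D₂) i rewrite lookup-zipWith _∧_ i Θ₁ Θ₂ = meet (at D₁ i) (at D₂ i)

SubstVInverse : Vec TType n → Vec SType m → (Fin k → Term n m) → Term k m → TType → Set
SubstVInverse {k = k} Γ Δ σ M τ =
  Σ[ Θ ∈ Vec TType k ] (Θ ⊢ M ∶ τ ∣ Δ) × (Γ ⊢ˢ σ ∶ Θ ∣ Δ)

substVInverse-merge : ∀ {σ : Fin k → Term n m} {M N P τ₁ τ₂} →
  (∀ {Θ} → Θ ⊢ M ∶ τ₁ ∣ Δ → Θ ⊢ N ∶ τ₂ ∣ Δ → Θ ⊢ P ∶ τ ∣ Δ) →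
  SubstVInverse Γ Δ σ M τ₁ → SubstVInverse Γ Δ σ N τ₂ → SubstVInverse Γ Δ σ P τ
substVInverse-merge rule (Θ₁ , D₁ , Dσ₁) (Θ₂ , D₂ , Dσ₂) =
  Θ₁ ⊓ Θ₂ , rule (narrowΓ (⊓-≤ˡ Θ₁ Θ₂) D₁) (narrowΓ (⊓-≤ʳ Θ₁ Θ₂) D₂) , ⊢ˢ-⊓ Dσ₁ Dσ₂

substVInverse-filter : ∀ {σ : Fin k → Term n m} {M} → Filter (SubstVInverse Γ Δ σ M)
upward   substVInverse-filter (Θ , DM , Dσ) p = Θ , sub DM p , Dσ
∧-closed substVInverse-filter = substVInverse-merge meet

substV⁻ : (σ : Fin k → Term n m) (M : Term k m) →
          Γ ⊢ˢ σ ∶ Θ₀ ∣ Δ → Γ ⊢ substV σ M ∶ τ ∣ Δ → SubstVInverse Γ Δ σ M τ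
substV⁻ {Θ₀ = Θ₀} {Δ = Δ} {τ = τ} σ (var x) Dσ D =
  Θ , subst (λ T → Θ ⊢ var x ∶ T ∣ Δ) (lookup∘update x Θ₀ τ) ax , Dσ'
  where
  Θ = Θ₀ [ x ]≔ τ
  Dσ' : _ ⊢ˢ σ ∶ Θ ∣ Δ
  at Dσ' i with i ≟ x
  ... | yes refl = subst (λ T → _ ⊢ σ i ∶ T ∣ Δ) (sym (lookup∘update x Θ₀ τ)) D
  ... | no i≢x   = subst (λ T → _ ⊢ σ i ∶ T ∣ Δ) (sym (lookup∘update′ i≢x Θ₀ τ)) (at Dσ i)
substV⁻ σ (mu ([ a ] M)) Dσ D = mu-elim substVInverse-filter base D
  where
  base : ∀ {κ} → _ ⊢ᶜ [ a ] substV (renN suc ∘ σ) M ∣ κ ∷ _ →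
         SubstVInverse _ _ σ (mu ([ a ] M)) (κ ⇒ν)
  base D' with substV⁻ (renN suc ∘ σ) M (renN-suc-⊢ˢ Dσ) D'
  ... | Θ , DM , Dσ' = Θ , mu-intro DM , record { at = λ i → renN-suc⁻ (σ i) (at Dσ' i) }
substV⁻ σ M Dσ (sub D p)  = upward substVInverse-filter (substV⁻ σ M Dσ D) p
substV⁻ σ M Dσ (meet D E) = ∧-closed substVInverse-filter (substV⁻ σ M Dσ D) (substV⁻ σ M Dσ E)
substV⁻ σ (lam M) Dσ (abs D) with substV⁻ (exts σ) M (exts-⊢ˢ Dσ) D
... | δ ∷ Θ , DM , Dσ' =
  Θ , abs (narrowΓ (var-gen (at Dσ' zero) ∷ Pointwise.refl reflₜ) DM) ,
  record { at = λ i → renV-suc⁻ (σ i) (at Dσ' (suc i)) }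
substV⁻ σ (app M N) Dσ (appT D E) =
  substVInverse-merge appT (substV⁻ σ M Dσ D) (substV⁻ σ N Dσ E)

StrSubInverse : Vec TType n → Vec SType m → Term n m → Fin m → Term n m → TType → Set
StrSubInverse Γ Δ P α L τ =
  Σ[ δ ∈ TType ] (Γ ⊢ P ∶ τ ∣ Δ [ α ]≔ δ ×ₛ lookup Δ α) × (Γ ⊢ L ∶ δ ∣ Δ)

strSubInverse-merge : ∀ {P Q R τ₁ τ₂} →
  (∀ {Δ'} → Γ ⊢ P ∶ τ₁ ∣ Δ' → Γ ⊢ Q ∶ τ₂ ∣ Δ' → Γ ⊢ R ∶ τ ∣ Δ') →
  StrSubInverse Γ Δ P α L τ₁ → StrSubInverse Γ Δ Q α L τ₂ → StrSubInverse Γ Δ R α L τ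
strSubInverse-merge {Δ = Δ} {α = α} rule (δ₁ , D₁ , L₁) (δ₂ , D₂ , L₂) =
  δ₁ ∧ δ₂ ,
  rule (narrowΔ (≔-mono Δ α (mono-× ∧-lbₜ reflₛ)) D₁)
       (narrowΔ (≔-mono Δ α (mono-× ∧-rbₜ reflₛ)) D₂) ,
  meet L₁ L₂

strSubInverse-filter : ∀ {P} → Filter (StrSubInverse Γ Δ P α L)
upward   strSubInverse-filter (δ , DP , DL) p = δ , sub DP p , DL
∧-closed strSubInverse-filter = strSubInverse-merge meet

mutual
  strSub⁻ : ∀ {δL} (P : Term n m) → Γ ⊢ L ∶ δL ∣ Δ →
            Γ ⊢ strSub P α L ∶ τ ∣ Δ → StrSubInverse Γ Δ P α L τ
  strSub⁻ (var x) DL D = _ , sub ax (var-gen D) , DL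
  strSub⁻ {L = L} (mu C) DL D = mu-elim strSubInverse-filter base D
    where
    base : ∀ {κ} → _ ⊢ᶜ strSubC C (suc _) (renN suc L) ∣ κ ∷ _ →
           StrSubInverse _ _ (mu C) _ L (κ ⇒ν)
    base D' with strSubC⁻ C (renN-suc⁺ DL) D'
    ... | δ , DC , DL' = δ , mu-intro DC , renN-suc⁻ L DL'
  strSub⁻ P DL (sub D p)  = upward strSubInverse-filter (strSub⁻ P DL D) p
  strSub⁻ P DL (meet D E) = ∧-closed strSubInverse-filter (strSub⁻ P DL D) (strSub⁻ P DL E)
  strSub⁻ {L = L} (lam P) DL (abs D) with strSub⁻ P (renV-suc⁺ DL) D
  ... | δ , DP , DL' = δ , abs DP , renV-suc⁻ L DL'
  strSub⁻ (app P Q) DL (appT D E) = strSubInverse-merge appT (strSub⁻ P DL D) (strSub⁻ Q DL E)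

  strSubC⁻ : ∀ {δL} (C : Cmd n m) → Γ ⊢ L ∶ δL ∣ Δ → Γ ⊢ᶜ strSubC C α L ∣ Δ →
             Σ[ δ ∈ TType ] (Γ ⊢ᶜ C ∣ Δ [ α ]≔ δ ×ₛ lookup Δ α) × (Γ ⊢ L ∶ δ ∣ Δ)
  strSubC⁻ {α = α} ([ a ] P) DL D with a ≟ α
  -- δ₁ types the copy of L applied at this command, δ₂ the copies inside P.
  strSubC⁻ {Γ = Γ} {Δ = Δ} ([ a ] P) DL D | yes refl with app-gen D here
  ... | δ₁ , DP , DL₁ with strSub⁻ P DL DP
  ...   | δ₂ , DP' , DL₂ =
    δ₁ ∧ δ₂ ,
    subst (λ κ → Γ ⊢ P ∶ κ ⇒ν ∣ Δ [ a ]≔ κ₁₂) (sym (lookup∘update a Δ κ₁₂))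
          (sub (narrowΔ (≔-mono Δ a (mono-× ∧-rbₜ reflₛ)) DP') (⇒-contra (mono-× ∧-lbₜ reflₛ))) ,
    meet DL₁ DL₂
    where κ₁₂ = (δ₁ ∧ δ₂) ×ₛ lookup Δ a
  strSubC⁻ {Γ = Γ} {Δ = Δ} ([ a ] P) DL D | no a≢α with strSub⁻ P DL D
  ... | δ , DP , DL' =
    δ , subst (λ κ → Γ ⊢ P ∶ κ ⇒ν ∣ _) (sym (lookup∘update′ a≢α Δ _)) DP , DL'

app-lam-intro : ∀ {M N δ'} → (δ' ∷ Γ) ⊢ M ∶ δ ∣ Δ → Γ ⊢ N ∶ δ' ∣ Δ →
                Γ ⊢ app (lam M) N ∶ δ ∣ Δ
app-lam-intro {δ = ν}       DM DN = sub (appT (abs {κ = ω} (sub DM ν≤ων)) DN) ων≤ν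
app-lam-intro {δ = ω⇒ν}     DM DN = appT (abs {κ = ω} DM) DN
app-lam-intro {δ = κ ⇒ν}    DM DN = appT (abs {κ = stk κ} DM) DN
app-lam-intro {δ = δ₁ ∧ δ₂} DM DN =
  meet (app-lam-intro (sub DM ∧-lbₜ) DN) (app-lam-intro (sub DM ∧-rbₜ) DN)

β-expansion : ∀ {M : Term (suc n) m} {N δ'} →
              Γ ⊢ M [ N /0] ∶ δ ∣ Δ → Γ ⊢ N ∶ δ' ∣ Δ → Γ ⊢ app (lam M) N ∶ δ ∣ Δ
β-expansion {M = M} {N} D DN with substV⁻ (single N) M (single-⊢ˢ DN) D
... | δ' ∷ Θ , DM , Dσ = app-lam-intro (narrowΓ (reflₜ ∷ Γ≤Θ) DM) (at Dσ zero)
  where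
  Γ≤Θ = extensional⇒inductive (pointwise λ x → var-gen (at Dσ (suc x)))

μ-expansion : ∀ {β : Fin (suc m)} {M N δ'} →
              Γ ⊢ mu (strSubC ([ β ] M) zero (renN suc N)) ∶ δ ∣ Δ → Γ ⊢ N ∶ δ' ∣ Δ →
              Γ ⊢ app (mu ([ β ] M)) N ∶ δ ∣ Δ
μ-expansion {β = β} {M} {N} D DN = mu-elim typing-filter base D
  where
  base : ∀ {κ} → _ ⊢ᶜ strSubC ([ β ] M) zero (renN suc N) ∣ κ ∷ _ →
         _ ⊢ app (mu ([ β ] M)) N ∶ κ ⇒ν ∣ _
  base D' with strSubC⁻ ([ β ] M) (renN-suc⁺ DN) D'
  ... | δ , DC , DN' = appT {κ = stk _} (mu-intro DC) (renN-suc⁻ N DN')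

lemma2p21 :
    (∀ {n m} {Γ : Vec TType n} {Δ : Vec SType m}
       {M : Term (suc n) m} {N : Term n m} {δ δ' : TType} →
       Γ ⊢ M [ N /0] ∶ δ ∣ Δ → Γ ⊢ N ∶ δ' ∣ Δ →
       Γ ⊢ app (lam M) N ∶ δ ∣ Δ)
    ×
    (∀ {n m} {Γ : Vec TType n} {Δ : Vec SType m}
       {β : Fin (suc m)} {M : Term n (suc m)} {N : Term n m} {δ δ' : TType} →
       Γ ⊢ mu (strSubC ([ β ] M) zero (renN suc N)) ∶ δ ∣ Δ → Γ ⊢ N ∶ δ' ∣ Δ →
       Γ ⊢ app (mu ([ β ] M)) N ∶ δ ∣ Δ)
lemma2p21 = β-expansion , μ-expansion
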